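{- The graph $\mathcal U_{\mathrm{fin}}$ is indivisible: for every partition $A_0\cup A_1$ of its vertex set, one of the induced subgraphs $\mathcal U_{\mathrm{fin}}\restriction_{A_0}$, $\mathcal U_{\mathrm{fin}}\restriction_{A_1}$ contains an induced subgraph isomorphic to $\mathcal U_{\mathrm{fin}}$.
   Context: The isolated union $\sum_{i}H_i$ is the disjoint union of graphs with no edges between different summands. $\mathcal U_{\mathrm{fin}}=\sum_{i<\omega}H_i$, where $(H_i)_{i<\omega}$ lists finite graphs so that every finite graph appears, up to isomorphism, infinitely often. -}

module Defs where

open import Level using (0ℓ)
open import Data.Bool using (Bool; true; false)
open import Data.Nat using (ℕ; _≤_; _≟_)
open import Data.Fin using (Fin)
open import Data.Product using (Σ; ∃; _×_; _,_)
open import Function.Bundles using (_↔_; Inverse)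
open import Relation.Nullary using (yes; no)
open import Relation.Binary.PropositionalEquality using (_≡_; refl)

record FinGraph : Set where
  field
    size  : ℕ
    adj   : Fin size → Fin size → Bool
    sym   : ∀ i j → adj i j ≡ adj j i
    irrefl : ∀ i → adj i i ≡ false
open FinGraph public

FinIso : FinGraph → FinGraph → Set
FinIso G H = Σ (Fin (size G) ↔ Fin (size H)) λ e →
  ∀ i j → adj H (Inverse.to e i) (Inverse.to e j) ≡ adj G i j

IsRichEnumeration : (ℕ → FinGraph) → Set
IsRichEnumeration H = ∀ (G : FinGraph) (k : ℕ) → ∃ λ i → k ≤ i × FinIso G (H i)

UVert : (ℕ → FinGraph) → Set
UVert H = Σ ℕ λ i → Fin (size (H i))

UAdj : (H : ℕ → FinGraph) → UVert H → UVert H → Bool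
UAdj H (i , x) (j , y) with i ≟ j
... | yes refl = adj (H i) x y
... | no _ = false

-- An induced embedding of the graph (V, E) into itself: an injective map
-- preserving adjacency and non-adjacency (i.e. an isomorphism onto an induced subgraph).
IsInducedEmbedding : {V : Set} → (V → V → Bool) → (V → V) → Set
IsInducedEmbedding {V} E f =
  (∀ u v → f u ≡ f v → u ≡ v) × (∀ u v → E (f u) (f v) ≡ E u v)

{-# OPTIONS --safe #-}
module Submission where

-- Fix a 2-colouring c of U. If for every finite graph G the summands containing a
-- c-monochromatic true copy of G are unbounded, then choose, summand by summand, a
-- true copy of H j inside some H (idx j) with idx strictly increasing: this is a
-- true-coloured self-embedding of U. Otherwise some G has no true copy in any H i
-- with i ≥ k. Every finite K is then isomorphic to the lexicographic product G[K] in
-- some late summand, and there picking one true vertex in every K-fibre would give a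
-- true copy of G; so some fibre is entirely false, a false copy of K. Hence the false
-- copies are unbounded and the first argument applies with colour false.

open import Defs hiding (sym)
open import Level using (0ℓ)
open import Axiom.ExcludedMiddle using (ExcludedMiddle)
open import Axiom.DoubleNegationElimination using (em⇒dne)
open import Data.Bool using (Bool; true; false)
import Data.Bool.Properties as Bool
open import Data.Empty using (⊥-elim)
open import Data.Fin using (Fin; combine; remQuot)
import Data.Fin as Fin
open import Data.Fin.Properties using (remQuot-combine; combine-injective; any?; all?; ¬∀⟶∃¬)
open import Data.Nat using (ℕ; zero; suc; _≤_; _<_; _⊔_; _*_)
import Data.Nat as ℕ
open import Data.Nat.Properties
  using (<-trans; <-cmp; <⇒≢; >⇒≢; m≤n⇒m<n∨m≡n; m<1+n⇒m≤n; m⊔n≤o⇒m≤o; m⊔n≤o⇒n≤o; ≡-irrelevant)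
open import Data.Product using (Σ; ∃; ∃₂; _×_; _,_; proj₁; proj₂)
open import Data.Product.Properties using (,-injectiveˡ; ,-injectiveʳ-UIP)
open import Data.Sum using (_⊎_; inj₁; inj₂; [_,_])
open import Function using (_∘_)
open import Function.Bundles using (Inverse; Injection)
open import Function.Definitions using (Injective)
open import Function.Properties.Inverse using (↔⇒↣)
open import Relation.Binary using (tri<; tri≈; tri>)
open import Relation.Binary.PropositionalEquality using (_≡_; _≢_; refl; sym; trans; cong; cong₂)
open import Relation.Nullary using (¬_; Dec; yes; no)

private
  variable
    A : Set
    b : Bool
    m n : ℕ
    G K L : FinGraph

infix 4 _↪_

record _↪_ (G K : FinGraph) : Set where
  field
    map           : Fin (size G) → Fin (size K)
    map-injective : Injective _≡_ _≡_ map
    map-adj       : ∀ x y → adj K (map x) (map y) ≡ adj G x y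
open _↪_

_∘↪_ : K ↪ L → G ↪ K → G ↪ L
f ∘↪ e = record
  { map           = map f ∘ map e
  ; map-injective = map-injective e ∘ map-injective f
  ; map-adj       = λ x y → trans (map-adj f _ _) (map-adj e x y)
  }

iso⇒↪ : FinIso G K → G ↪ K
iso⇒↪ (e , e-adj) = record
  { map           = Inverse.to e
  ; map-injective = Injection.injective (↔⇒↣ e)
  ; map-adj       = e-adj
  }

MonochromaticCopy : (G K : FinGraph) → (Fin (size K) → Bool) → Bool → Set
MonochromaticCopy G K χ b = Σ (G ↪ K) λ e → ∀ x → χ (map e x) ≡ b

push-copy : (χ : Fin (size L) → Bool) (f : K ↪ L) →
            MonochromaticCopy G K (χ ∘ map f) b → MonochromaticCopy G L χ b
push-copy _ f (e , mono) = f ∘↪ e , mono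

module _ (G K : FinGraph) where

  lexAdj : Fin (size G) × Fin (size K) → Fin (size G) × Fin (size K) → Bool
  lexAdj (g , κ) (g′ , κ′) with g Fin.≟ g′
  ... | yes _ = adj K κ κ′
  ... | no _  = adj G g g′

  lexAdj-fibre : ∀ g κ κ′ → lexAdj (g , κ) (g , κ′) ≡ adj K κ κ′
  lexAdj-fibre g κ κ′ with g Fin.≟ g
  ... | yes _  = refl
  ... | no g≢g = ⊥-elim (g≢g refl)

  lexAdj-section : ∀ (s : Fin (size G) → Fin (size K)) x y →
                   lexAdj (x , s x) (y , s y) ≡ adj G x y
  lexAdj-section s x y with x Fin.≟ y
  ... | yes refl = trans (irrefl K (s x)) (sym (irrefl G x))
  ... | no _     = refl

  lexAdj-sym : ∀ p q → lexAdj p q ≡ lexAdj q p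
  lexAdj-sym (g , κ) (g′ , κ′) with g Fin.≟ g′ | g′ Fin.≟ g
  ... | yes _   | yes _   = FinGraph.sym K κ κ′
  ... | yes g≡g′ | no g′≢g = ⊥-elim (g′≢g (sym g≡g′))
  ... | no g≢g′ | yes g′≡g = ⊥-elim (g≢g′ (sym g′≡g))
  ... | no _    | no _    = FinGraph.sym G g g′

  lexAdj-irrefl : ∀ p → lexAdj p p ≡ false
  lexAdj-irrefl (g , κ) = trans (lexAdj-fibre g κ κ) (irrefl K κ)

infixl 10 _[_]
_[_] : FinGraph → FinGraph → FinGraph
G [ K ] = record
  { size   = size G * size K
  ; adj    = λ u v → lexAdj G K (split u) (split v)
  ; sym    = λ u v → lexAdj-sym G K (split u) (split v)
  ; irrefl = λ u → lexAdj-irrefl G K (split u)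
  }
  where
  split : Fin (size G * size K) → Fin (size G) × Fin (size K)
  split = remQuot (size K)

[]-adj-combine : ∀ g κ g′ κ′ →
                 adj (G [ K ]) (combine g κ) (combine g′ κ′) ≡ lexAdj G K (g , κ) (g′ , κ′)
[]-adj-combine {G} {K} g κ g′ κ′ =
  cong₂ (lexAdj G K) (remQuot-combine g κ) (remQuot-combine g′ κ′)

fibre↪ : Fin (size G) → K ↪ G [ K ]
fibre↪ {G} {K} g = record
  { map           = combine g
  ; map-injective = λ {κ} {κ′} → proj₂ ∘ combine-injective g κ g κ′
  ; map-adj       = λ κ κ′ → trans ([]-adj-combine g κ g κ′) (lexAdj-fibre G K g κ κ′)
  }

section↪ : (Fin (size G) → Fin (size K)) → G ↪ G [ K ]
section↪ {G} {K} s = record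
  { map           = λ x → combine x (s x)
  ; map-injective = λ {x} {y} → proj₁ ∘ combine-injective x (s x) y (s y)
  ; map-adj       = λ x y → trans ([]-adj-combine x (s x) y (s y)) (lexAdj-section G K s x y)
  }

true-section-or-false-row : (P : Fin m → Fin n → Bool) →
  (∃ λ s → ∀ x → P x (s x) ≡ true) ⊎ (∃ λ x → ∀ y → P x y ≡ false)
true-section-or-false-row {m} P with all? (λ x → any? (λ y → P x y Bool.≟ true))
... | yes every-row-true = inj₁ ((proj₁ ∘ every-row-true) , (proj₂ ∘ every-row-true))
... | no ¬every-row-true with ¬∀⟶∃¬ m _ (λ x → any? (λ y → P x y Bool.≟ true)) ¬every-row-true
...   | x , no-true = inj₂ (x , λ y → Bool.¬-not (λ P≡true → no-true (y , P≡true)))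

lex-monochromatic : (χ : Fin (size (G [ K ])) → Bool) →
  MonochromaticCopy G (G [ K ]) χ true ⊎ MonochromaticCopy K (G [ K ]) χ false
lex-monochromatic χ with true-section-or-false-row (λ g κ → χ (combine g κ))
... | inj₁ (s , s-true)  = inj₁ (section↪ s , s-true)
... | inj₂ (g , g-false) = inj₂ (fibre↪ g , g-false)

cofinal-or-eventually-absent : ExcludedMiddle 0ℓ → (P : A → ℕ → Set) →
  (∀ a k → ∃ λ i → k ≤ i × P a i) ⊎ (∃₂ λ a k → ∀ i → k ≤ i → ¬ P a i)
cofinal-or-eventually-absent em P with em {∃₂ λ a k → ∀ i → k ≤ i → ¬ P _ i}
... | yes absent  = inj₂ absent
... | no ¬absent = inj₁ λ a k →
  em⇒dne em λ ¬cofinal → ¬absent (a , k , λ i k≤i p → ¬cofinal (i , k≤i , p))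

strictlyIncreasing⇒monotone : (f : ℕ → ℕ) → (∀ j → f j < f (suc j)) →
                              ∀ {i j} → i < j → f i < f j
strictlyIncreasing⇒monotone f step {i} {suc j} i<1+j with m≤n⇒m<n∨m≡n (m<1+n⇒m≤n i<1+j)
... | inj₁ i<j  = <-trans (strictlyIncreasing⇒monotone f step i<j) (step j)
... | inj₂ refl = step i

strictlyIncreasing⇒injective : (f : ℕ → ℕ) → (∀ j → f j < f (suc j)) → Injective _≡_ _≡_ f
strictlyIncreasing⇒injective f step {i} {j} fi≡fj with <-cmp i j
... | tri< i<j _ _ = ⊥-elim (<⇒≢ (strictlyIncreasing⇒monotone f step i<j) fi≡fj)
... | tri≈ _ i≡j _ = i≡j
... | tri> _ _ j<i = ⊥-elim (>⇒≢ (strictlyIncreasing⇒monotone f step j<i) fi≡fj)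

-- Each choice is made above the previous one, which makes the choices injective.
cofinal-choice : {P : ℕ → ℕ → Set} → (∀ j k → ∃ λ i → k ≤ i × P j i) →
  ∃ λ (idx : ℕ → ℕ) → Injective _≡_ _≡_ idx × (∀ j → P j (idx j))
cofinal-choice {P} next =
  idx , strictlyIncreasing⇒injective idx (λ j → proj₁ (proj₂ (chosen (suc j))))
      , λ j → proj₂ (proj₂ (chosen j))
  where
  lowerBound : ℕ → ℕ
  chosen : ∀ j → ∃ λ i → lowerBound j ≤ i × P j i
  lowerBound zero    = 0
  lowerBound (suc j) = suc (proj₁ (chosen j))
  chosen j = next j (lowerBound j)

  idx : ℕ → ℕ
  idx = proj₁ ∘ chosen

module IsolatedUnion (H : ℕ → FinGraph) where

  UAdj-same : ∀ i (x y : Fin (size (H i))) → UAdj H (i , x) (i , y) ≡ adj (H i) x y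
  UAdj-same i x y with i ℕ.≟ i
  ... | yes refl = refl
  ... | no i≢i   = ⊥-elim (i≢i refl)

  UAdj-distinct : ∀ {i j} (x : Fin (size (H i))) (y : Fin (size (H j))) → i ≢ j →
                  UAdj H (i , x) (j , y) ≡ false
  UAdj-distinct {i} {j} x y i≢j with i ℕ.≟ j
  ... | yes i≡j = ⊥-elim (i≢j i≡j)
  ... | no _    = refl

  summandwise : (idx : ℕ → ℕ) → (∀ j → H j ↪ H (idx j)) → UVert H → UVert H
  summandwise idx e (j , x) = idx j , map (e j) x

  summandwise-embedding : {idx : ℕ → ℕ} → Injective _≡_ _≡_ idx → (e : ∀ j → H j ↪ H (idx j)) →
                          IsInducedEmbedding (UAdj H) (summandwise idx e)
  summandwise-embedding {idx} idx-injective e = injective , adj-preserving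
    where
    injective : ∀ u v → summandwise idx e u ≡ summandwise idx e v → u ≡ v
    injective (j , x) (j′ , y) eq with idx-injective (,-injectiveˡ eq)
    ... | refl = cong (j ,_) (map-injective (e j) (,-injectiveʳ-UIP ≡-irrelevant eq))

    adj-preserving : ∀ u v → UAdj H (summandwise idx e u) (summandwise idx e v) ≡ UAdj H u v
    adj-preserving (j , x) (j′ , y) = by-cases x y (j ℕ.≟ j′)
      where
      by-cases : ∀ {j j′} x y → Dec (j ≡ j′) →
                 UAdj H (summandwise idx e (j , x)) (summandwise idx e (j′ , y)) ≡ UAdj H (j , x) (j′ , y)
      by-cases {j} x y (yes refl) =
        trans (UAdj-same (idx j) _ _) (trans (map-adj (e j) x y) (sym (UAdj-same j x y)))
      by-cases x y (no j≢j′) =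
        trans (UAdj-distinct _ _ (j≢j′ ∘ idx-injective)) (sym (UAdj-distinct x y j≢j′))

rich↪ : {H : ℕ → FinGraph} → IsRichEnumeration H → ∀ G k → ∃ λ i → k ≤ i × G ↪ H i
rich↪ rich G k with rich G k
... | i , k≤i , iso = i , k≤i , iso⇒↪ iso

module Colouring (H : ℕ → FinGraph) (c : UVert H → Bool) where
  open IsolatedUnion H

  colour : ∀ i → Fin (size (H i)) → Bool
  colour i x = c (i , x)

  Copy : Bool → FinGraph → ℕ → Set
  Copy b G i = MonochromaticCopy G (H i) (colour i) b

  monochromatic-self-embedding : (∀ j k → ∃ λ i → k ≤ i × Copy b (H j) i) →
    Σ (UVert H → UVert H) λ f → IsInducedEmbedding (UAdj H) f × (∀ v → c (f v) ≡ b)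
  monochromatic-self-embedding cofinal with cofinal-choice cofinal
  ... | idx , idx-injective , copies =
    summandwise idx (proj₁ ∘ copies) ,
    summandwise-embedding idx-injective (proj₁ ∘ copies) ,
    λ (j , x) → proj₂ (copies j) x

  absent-true⇒cofinal-false : IsRichEnumeration H → ∀ {k} →
    (∀ i → k ≤ i → ¬ Copy true G i) → ∀ K k′ → ∃ λ i → k′ ≤ i × Copy false K i
  absent-true⇒cofinal-false {G} rich {k} absent K k′ with rich↪ rich (G [ K ]) (k ⊔ k′)
  ... | i , k⊔k′≤i , e with lex-monochromatic (colour i ∘ map e)
  ...   | inj₁ true-G  = ⊥-elim (absent i (m⊔n≤o⇒m≤o k k′ k⊔k′≤i) (push-copy (colour i) e true-G))
  ...   | inj₂ false-K = i , m⊔n≤o⇒n≤o k k′ k⊔k′≤i , push-copy (colour i) e false-K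

corollary4p4 : ExcludedMiddle 0ℓ →
    (H : ℕ → FinGraph) → IsRichEnumeration H →
    (c : UVert H → Bool) →
    ∃ λ (b : Bool) → Σ (UVert H → UVert H) λ f →
      IsInducedEmbedding (UAdj H) f × (∀ v → c (f v) ≡ b)
corollary4p4 em H rich c =
  [ (λ true-cofinal → true , monochromatic-self-embedding (true-cofinal ∘ H))
  , (λ (_ , _ , absent) → false ,
       monochromatic-self-embedding (absent-true⇒cofinal-false rich absent ∘ H))
  ] (cofinal-or-eventually-absent em (Copy true))
  where open Colouring H c
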